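{- Let $l$ be a positive integer and let $H$ be an $l$-ARS-graph. Then $\chi_c(H)=l$, and there exists an integer $n_0$ such that every graph $G\in\operatorname{red}(H)$ with $|V(G)|\ge n_0$ contains at most one non-edge. In particular, $H$ is $2$-critical.
   Context: All graphs are finite and simple. $\operatorname{Forb}(H)$ is the family of graphs with no induced subgraph isomorphic to $H$. $\mathcal{H}(s,t)$ is the family of graphs whose vertex set can be partitioned into $s$ stable sets and $t$ cliques. $\chi_c(H)$ is the maximum integer $l$ such that $H\notin\mathcal{H}(s,l-s)$ for some $0\le s\le l$; equivalently, for a hereditary family $\mathcal{F}$, $\chi_c(\mathcal{F})$ is the maximum $l$ with $\mathcal{H}(s,l-s)\subseteq\mathcal{F}$ for some $0\le s\le l$, and $\chi_c(H)=\chi_c(\operatorname{Forb}(H))$. For a hereditary $\mathcal{F}$ with $l=\chi_c(\mathcal{F})$, a graph $J$ is $\mathcal{F}$-reduced if for some $0\le s\le l-1$, $\mathcal{F}$ contains every graph whose vertex set can be partitioned into $l$ parts where the first part induces a graph isomorphic to an induced subgraph of $J$, $s$ other parts are stable sets and the remaining $l-1-s$ are cliques; $\operatorname{red}(H)$ is the family of $\operatorname{Forb}(H)$-reduced graphs. A graph $G$ is an $s$-star if there is $S\subseteq V(G)$, $|S|\le s$, such that $V(G)\setminus S$ is a clique or stable set and each vertex of $S$ is adjacent to all or to none of $V(G)\setminus S$. $H$ is $s$-critical if there is $n_0$ such that every $K\in\operatorname{red}(H)$ with $|V(K)|\ge n_0$ is an $s$-star. Notation: $\mathcal{C}$ is the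 family of complete graphs; $S_k$ the edgeless graph on $k$ vertices; $K_1$ the one-vertex graph; $C_4$ the $4$-cycle; $\bar P_3$ the complement of the $3$-vertex path; $\iota(J)$ the family of graphs isomorphic to induced subgraphs of $J$; $\mathcal{F}_1\vee\mathcal{F}_2$ (resp. $\mathcal{F}_1\wedge\mathcal{F}_2$) the family of disjoint unions (resp. joins) of a graph in $\mathcal{F}_1$ and a graph in $\mathcal{F}_2$. A graph $H$ is an $l$-ARS-graph if: (ARS1) for every $1\le s\le l$, $V(H)$ can be partitioned into $s$ stable sets and $l-s$ cliques; (ARS2) for each $\mathcal{G}\in\{\iota(K_1)\vee\mathcal{C},\iota(S_3)\wedge\mathcal{C},\iota(C_4)\wedge\mathcal{C},\iota(\bar P_3)\wedge\mathcal{C}\}$, $V(H)$ can be partitioned into $l-1$ cliques and a set inducing a graph in $\mathcal{G}$; (ARS3) there is a partition $\mathcal{X}_0=\{X_1,\dots,X_l\}$ of $V(H)$ with $X_1,\dots,X_{l-2}$ cliques, each of $H[X_{l-1}],H[X_l]$ having exactly one non-edge, and the vertices of these two non-edges forming an independent set of $H$; (ARS4) for every partition $\mathcal{X}\neq\mathcal{X}_0$ of $V(H)$ with $|\mathcal{X}|=l$ some $X\in\mathcal{X}$ has $H[X]$ with at least two non-edges. -}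

module Defs where

open import Data.Nat using (ℕ; zero; suc; _+_; _∸_; _≤_; _<_)
open import Data.Fin using (Fin; zero; suc; toℕ)
open import Data.Fin.Subset using (Subset; _∈_; _∉_; ∣_∣)
open import Data.Bool using (Bool; true; false)
open import Data.Maybe using (Maybe; just; nothing)
open import Data.Product using (Σ; Σ-syntax; ∃; ∃-syntax; _×_; _,_)
open import Data.Sum using (_⊎_)
open import Relation.Nullary using (¬_)
open import Relation.Binary.PropositionalEquality using (_≡_; _≢_; refl)

record Graph : Set where
  field
    n      : ℕ
    adj    : Fin n → Fin n → Bool
    sym    : ∀ x y → adj x y ≡ adj y x
    irrefl : ∀ x → adj x x ≡ false
open Graph public

_≤ᵢ_ : Graph → Graph → Set
H ≤ᵢ G = Σ[ f ∈ (Fin (n H) → Fin (n G)) ]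
           (∀ x y → f x ≡ f y → x ≡ y) ×
           (∀ x y → adj G (f x) (f y) ≡ adj H x y)

Forb : Graph → Graph → Set
Forb H G = ¬ (H ≤ᵢ G)

Stable : (G : Graph) → (Fin (n G) → Set) → Set
Stable G A = ∀ x y → A x → A y → x ≢ y → adj G x y ≡ false

Clique : (G : Graph) → (Fin (n G) → Set) → Set
Clique G A = ∀ x y → A x → A y → x ≢ y → adj G x y ≡ true

NonEdge : (G : Graph) → Fin (n G) → Fin (n G) → Set
NonEdge G x y = x ≢ y × adj G x y ≡ false

SamePair : {m : ℕ} → Fin m → Fin m → Fin m → Fin m → Set
SamePair a b c d = (a ≡ c × b ≡ d) ⊎ (a ≡ d × b ≡ c)

ExactlyOneNonEdgeAt : (G : Graph) → (Fin (n G) → Set) → Fin (n G) → Fin (n G) → Set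
ExactlyOneNonEdgeAt G A u v =
  A u × A v × NonEdge G u v ×
  (∀ x y → A x → A y → NonEdge G x y → SamePair x y u v)

AtLeastTwoNonEdges : (G : Graph) → (Fin (n G) → Set) → Set
AtLeastTwoNonEdges G A =
  Σ[ a ∈ Fin (n G) ] Σ[ b ∈ Fin (n G) ] Σ[ c ∈ Fin (n G) ] Σ[ d ∈ Fin (n G) ]
    A a × A b × A c × A d × NonEdge G a b × NonEdge G c d × ¬ SamePair a b c d

AtMostOneNonEdge : Graph → Set
AtMostOneNonEdge G =
  ∀ a b c d → NonEdge G a b → NonEdge G c d → SamePair a b c d

EmbedsInto : (G : Graph) → (Fin (n G) → Set) → Graph → Set
EmbedsInto G A J =
  Σ[ f ∈ ((x : Fin (n G)) → A x → Fin (n J)) ]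
    (∀ x y (ax : A x) (ay : A y) → f x ax ≡ f y ay → x ≡ y) ×
    (∀ x y (ax : A x) (ay : A y) → adj J (f x ax) (f y ay) ≡ adj G x y)

-- H(s,t): V(G) partitioned into s stable sets and t cliques
-- (parts are indexed by Fin (s + t); indices < s are the stable sets;
--  parts may be empty)

InH : Graph → ℕ → ℕ → Set
InH G s t = Σ[ c ∈ (Fin (n G) → Fin (s + t)) ]
  (∀ i → (toℕ i < s → Stable G (λ v → c v ≡ i)) ×
         (s ≤ toℕ i → Clique G (λ v → c v ≡ i)))

IsChiC : Graph → ℕ → Set
IsChiC H l =
  (Σ[ s ∈ ℕ ] s ≤ l × ¬ InH H s (l ∸ s)) ×
  (∀ l′ → l < l′ → ∀ s → s ≤ l′ → InH H s (l′ ∸ s))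

-- Forb(H)-reduced graphs, where l = χ_c(Forb(H)) = χ_c(H) is given as a
-- parameter. Parts are indexed by Fin l: part 0 induces a graph in ι(J),
-- parts 1..s are stable sets, parts s+1..l-1 are cliques.

IsRed : Graph → ℕ → Graph → Set
IsRed H l J = Σ[ s ∈ ℕ ] s < l ×
  (∀ (K : Graph) (c : Fin (n K) → Fin l) →
     (∀ i → (toℕ i ≡ 0 → EmbedsInto K (λ v → c v ≡ i) J) ×
            (0 < toℕ i → toℕ i ≤ s → Stable K (λ v → c v ≡ i)) ×
            (s < toℕ i → Clique K (λ v → c v ≡ i))) →
     Forb H K)

IsStar : ℕ → Graph → Set
IsStar s G = Σ[ S ∈ Subset (n G) ] ∣ S ∣ ≤ s ×
  (Clique G (λ v → v ∉ S) ⊎ Stable G (λ v → v ∉ S)) ×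
  (∀ v → v ∈ S → (∀ w → w ∉ S → adj G v w ≡ true) ⊎ (∀ w → w ∉ S → adj G v w ≡ false))

IsCritical : ℕ → Graph → ℕ → Set
IsCritical s H l = Σ[ n₀ ∈ ℕ ] ∀ K → IsRed H l K → n₀ ≤ n K → IsStar s K

K1-adj : Fin 1 → Fin 1 → Bool
K1-adj zero zero = false

K1-sym : ∀ x y → K1-adj x y ≡ K1-adj y x
K1-sym zero zero = refl

K1-irr : ∀ x → K1-adj x x ≡ false
K1-irr zero = refl

K1 : Graph
K1 = record { n = 1 ; adj = K1-adj ; sym = K1-sym ; irrefl = K1-irr }

S3-adj : Fin 3 → Fin 3 → Bool
S3-adj zero zero = false
S3-adj zero (suc zero) = false
S3-adj zero (suc (suc zero)) = false
S3-adj (suc zero) zero = false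
S3-adj (suc zero) (suc zero) = false
S3-adj (suc zero) (suc (suc zero)) = false
S3-adj (suc (suc zero)) zero = false
S3-adj (suc (suc zero)) (suc zero) = false
S3-adj (suc (suc zero)) (suc (suc zero)) = false

S3-sym : ∀ x y → S3-adj x y ≡ S3-adj y x
S3-sym zero zero = refl
S3-sym zero (suc zero) = refl
S3-sym zero (suc (suc zero)) = refl
S3-sym (suc zero) zero = refl
S3-sym (suc zero) (suc zero) = refl
S3-sym (suc zero) (suc (suc zero)) = refl
S3-sym (suc (suc zero)) zero = refl
S3-sym (suc (suc zero)) (suc zero) = refl
S3-sym (suc (suc zero)) (suc (suc zero)) = refl

S3-irr : ∀ x → S3-adj x x ≡ false
S3-irr zero = refl
S3-irr (suc zero) = refl
S3-irr (suc (suc zero)) = refl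

S3 : Graph
S3 = record { n = 3 ; adj = S3-adj ; sym = S3-sym ; irrefl = S3-irr }

C4-adj : Fin 4 → Fin 4 → Bool
C4-adj zero zero = false
C4-adj zero (suc zero) = true
C4-adj zero (suc (suc zero)) = false
C4-adj zero (suc (suc (suc zero))) = true
C4-adj (suc zero) zero = true
C4-adj (suc zero) (suc zero) = false
C4-adj (suc zero) (suc (suc zero)) = true
C4-adj (suc zero) (suc (suc (suc zero))) = false
C4-adj (suc (suc zero)) zero = false
C4-adj (suc (suc zero)) (suc zero) = true
C4-adj (suc (suc zero)) (suc (suc zero)) = false
C4-adj (suc (suc zero)) (suc (suc (suc zero))) = true
C4-adj (suc (suc (suc zero))) zero = true
C4-adj (suc (suc (suc zero))) (suc zero) = false
C4-adj (suc (suc (suc zero))) (suc (suc zero)) = true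
C4-adj (suc (suc (suc zero))) (suc (suc (suc zero))) = false

C4-sym : ∀ x y → C4-adj x y ≡ C4-adj y x
C4-sym zero zero = refl
C4-sym zero (suc zero) = refl
C4-sym zero (suc (suc zero)) = refl
C4-sym zero (suc (suc (suc zero))) = refl
C4-sym (suc zero) zero = refl
C4-sym (suc zero) (suc zero) = refl
C4-sym (suc zero) (suc (suc zero)) = refl
C4-sym (suc zero) (suc (suc (suc zero))) = refl
C4-sym (suc (suc zero)) zero = refl
C4-sym (suc (suc zero)) (suc zero) = refl
C4-sym (suc (suc zero)) (suc (suc zero)) = refl
C4-sym (suc (suc zero)) (suc (suc (suc zero))) = refl
C4-sym (suc (suc (suc zero))) zero = refl
C4-sym (suc (suc (suc zero))) (suc zero) = refl
C4-sym (suc (suc (suc zero))) (suc (suc zero)) = refl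
C4-sym (suc (suc (suc zero))) (suc (suc (suc zero))) = refl

C4-irr : ∀ x → C4-adj x x ≡ false
C4-irr zero = refl
C4-irr (suc zero) = refl
C4-irr (suc (suc zero)) = refl
C4-irr (suc (suc (suc zero))) = refl

C4 : Graph
C4 = record { n = 4 ; adj = C4-adj ; sym = C4-sym ; irrefl = C4-irr }

coP3-adj : Fin 3 → Fin 3 → Bool
coP3-adj zero zero = false
coP3-adj zero (suc zero) = false
coP3-adj zero (suc (suc zero)) = true
coP3-adj (suc zero) zero = false
coP3-adj (suc zero) (suc zero) = false
coP3-adj (suc zero) (suc (suc zero)) = false
coP3-adj (suc (suc zero)) zero = true
coP3-adj (suc (suc zero)) (suc zero) = false
coP3-adj (suc (suc zero)) (suc (suc zero)) = false

coP3-sym : ∀ x y → coP3-adj x y ≡ coP3-adj y x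
coP3-sym zero zero = refl
coP3-sym zero (suc zero) = refl
coP3-sym zero (suc (suc zero)) = refl
coP3-sym (suc zero) zero = refl
coP3-sym (suc zero) (suc zero) = refl
coP3-sym (suc zero) (suc (suc zero)) = refl
coP3-sym (suc (suc zero)) zero = refl
coP3-sym (suc (suc zero)) (suc zero) = refl
coP3-sym (suc (suc zero)) (suc (suc zero)) = refl

coP3-irr : ∀ x → coP3-adj x x ≡ false
coP3-irr zero = refl
coP3-irr (suc zero) = refl
coP3-irr (suc (suc zero)) = refl

coP3 : Graph
coP3 = record { n = 3 ; adj = coP3-adj ; sym = coP3-sym ; irrefl = coP3-irr }
-- ι(J) ∨ C  and  ι(J) ∧ C  for the graph G[Y]:
-- Y splits into A (inducing a graph in ι(J)) and a clique B, with no
-- edges (∨) resp. all edges (∧) between A and B.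

InUnionC : (G : Graph) → (Fin (n G) → Set) → Graph → Set
InUnionC G Y J = Σ[ side ∈ (Fin (n G) → Bool) ]
  EmbedsInto G (λ v → Y v × side v ≡ true) J ×
  Clique G (λ v → Y v × side v ≡ false) ×
  (∀ a b → Y a × side a ≡ true → Y b × side b ≡ false → adj G a b ≡ false)

InJoinC : (G : Graph) → (Fin (n G) → Set) → Graph → Set
InJoinC G Y J = Σ[ side ∈ (Fin (n G) → Bool) ]
  EmbedsInto G (λ v → Y v × side v ≡ true) J ×
  Clique G (λ v → Y v × side v ≡ false) ×
  (∀ a b → Y a × side a ≡ true → Y b × side b ≡ false → adj G a b ≡ true)

-- V(H) partitioned into k cliques and a set Y (label nothing) with H[Y] ∈ 𝒢
CliquesPlus : (H : Graph) → ℕ → ((Fin (n H) → Set) → Set) → Set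
CliquesPlus H k P = Σ[ c ∈ (Fin (n H) → Maybe (Fin k)) ]
  (∀ i → Clique H (λ v → c v ≡ just i)) × P (λ v → c v ≡ nothing)

ARS1 : Graph → ℕ → Set
ARS1 H l = ∀ s → 1 ≤ s → s ≤ l → InH H s (l ∸ s)

ARS2 : Graph → ℕ → Set
ARS2 H l =
  CliquesPlus H (l ∸ 1) (λ Y → InUnionC H Y K1) ×
  CliquesPlus H (l ∸ 1) (λ Y → InJoinC H Y S3) ×
  CliquesPlus H (l ∸ 1) (λ Y → InJoinC H Y C4) ×
  CliquesPlus H (l ∸ 1) (λ Y → InJoinC H Y coP3)

-- a partition of V(H) into l (nonempty) parts, given by a surjective labelling
IsPartition : (H : Graph) → (l : ℕ) → (Fin (n H) → Fin l) → Set
IsPartition H l c = ∀ i → ∃[ v ] c v ≡ i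

SamePartition : {m l l′ : ℕ} → (Fin m → Fin l) → (Fin m → Fin l′) → Set
SamePartition c c′ = ∀ x y → (c x ≡ c y → c′ x ≡ c′ y) × (c′ x ≡ c′ y → c x ≡ c y)

-- (ARS3) for the partition X₀ = c₀ (parts X_1..X_l are the labels 0..l-1)
ARS3 : (H : Graph) → (l : ℕ) → (Fin (n H) → Fin l) → Set
ARS3 H l c₀ = 2 ≤ l × IsPartition H l c₀ ×
  (∀ i → toℕ i < l ∸ 2 → Clique H (λ v → c₀ v ≡ i)) ×
  Σ[ i ∈ Fin l ] Σ[ j ∈ Fin l ] toℕ i ≡ l ∸ 2 × toℕ j ≡ l ∸ 1 ×
  Σ[ u₁ ∈ Fin (n H) ] Σ[ v₁ ∈ Fin (n H) ] Σ[ u₂ ∈ Fin (n H) ] Σ[ v₂ ∈ Fin (n H) ]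
    ExactlyOneNonEdgeAt H (λ v → c₀ v ≡ i) u₁ v₁ ×
    ExactlyOneNonEdgeAt H (λ v → c₀ v ≡ j) u₂ v₂ ×
    Stable H (λ v → v ≡ u₁ ⊎ v ≡ v₁ ⊎ v ≡ u₂ ⊎ v ≡ v₂)

ARS4 : (H : Graph) → (l : ℕ) → (Fin (n H) → Fin l) → Set
ARS4 H l c₀ = ∀ (c : Fin (n H) → Fin l) → IsPartition H l c →
  ¬ SamePartition c c₀ → Σ[ i ∈ Fin l ] AtLeastTwoNonEdges H (λ v → c v ≡ i)

IsARS : ℕ → Graph → Set
IsARS l H = ARS1 H l × ARS2 H l ×
  Σ[ c₀ ∈ (Fin (n H) → Fin l) ] ARS3 H l c₀ × ARS4 H l c₀

-- χ_c(H) ≥ l because H ∉ H(0, l): a partition of H into l cliques can be rearranged, by moving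
-- single vertices into empty parts, into one with l nonempty cliques; by (ARS4) it would be X₀,
-- whose last parts contain non-edges.  χ_c(H) ≤ l: (ARS1) and the ι(K₁) ∨ C split of (ARS2)
-- partition H into s stable sets and l′ − s cliques for every l′ > l.
--
-- Let G be Forb(H)-reduced with s stable parts and large, and N = |V(H)|.  By Ramsey, G has a
-- stable set or a clique on N vertices; either can host the part of an (ARS1)-partition that is
-- put into the ι(G)-slot, producing H in a forbidden family (a clique only when s > 0).  When s = 0 and G has two
-- distinct non-edges, either some vertex has many non-neighbours, among which Ramsey finds an
-- N-clique (giving ι(K₁) ∨ C), or the two non-edges induce S₃, P̄₃ or C₄, whose common
-- neighbourhood is still large and contains an N-clique (giving ι(J) ∧ C); stable N-sets being
-- excluded already, (ARS2) then splits H into l − 1 cliques and a part embedding into G.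
-- Finally, a graph with at most one non-edge is a 2-star.

module Submission where

open import Defs
open import Data.Bool using (Bool; true; false)
import Data.Bool.Properties as Bool
open import Data.Empty using (⊥-elim)
open import Data.Fin using (Fin; zero; suc; toℕ; fromℕ<; punchOut; _≟_) renaming (_<_ to _<ᶠ_)
open import Data.Fin.Properties
  using (toℕ-fromℕ<; toℕ-injective; toℕ<n; any?; pigeonhole; punchOut-injective; injective⇒≤)
  renaming (<-cmp to <ᶠ-cmp; <⇒≢ to <ᶠ⇒≢)
open import Data.Fin.Subset using (Subset; _∪_; ⁅_⁆; ∣_∣)
  renaming (⊥ to ∅; _∈_ to _∈ₛ_; _∉_ to _∉ₛ_)
open import Data.Fin.Subset.Properties using (∣⊥∣≡0; ∣⁅x⁆∣≡1; x∈⁅x⁆; x∈p∪q⁺)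
open import Data.List using (List; []; _∷_; length; filter; tabulate; allFin)
open import Data.List.Properties using (filter-all; length-tabulate)
open import Data.List.Membership.Propositional using (_∈_)
open import Data.List.Membership.Propositional.Properties using (∈-filter⁻)
open import Data.List.Relation.Unary.All as All using (All; []; _∷_)
open import Data.List.Relation.Unary.All.Properties using (all-filter; tabulate⁻)
open import Data.List.Relation.Unary.Any using (here; there)
open import Data.List.Relation.Unary.Unique.Propositional using (Unique; []; _∷_)
import Data.List.Relation.Unary.Unique.Propositional.Properties as Unique
open import Data.Maybe using (Maybe; just; nothing)
open import Data.Nat using (ℕ; zero; suc; _+_; _*_; _∸_; _≤_; _<_; z≤n; s≤s; _≤?_)
open import Data.Nat.Properties hiding (_≟_)
open import Data.Product using (Σ-syntax; ∃-syntax; _×_; _,_; proj₁; proj₂)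
open import Data.Sum as Sum using (_⊎_; inj₁; inj₂; [_,_])
open import Data.Unit using (⊤; tt)
open import Data.Vec using ([]; _∷_; lookup)
open import Data.Vec.Functional using (updateAt) renaming (_∷_ to _∷ᶠ_)
open import Data.Vec.Functional.Properties using (updateAt-updates; updateAt-minimal)
open import Function using (_∘_; _$_; const)
open import Relation.Binary.Definitions using (DecidableEquality; tri<; tri≈; tri>)
open import Relation.Binary.PropositionalEquality as ≡ using (_≡_; _≢_; refl; trans; cong; cong₂)
open import Relation.Nullary using (¬_; Dec; yes; no)
open import Relation.Nullary.Decidable using (¬?; _×-dec_; _⊎-dec_)
open import Relation.Unary using (Decidable)

module _ {A : Set} {P : A → Set} (P? : Decidable P) where

  length-filter-∷ : ∀ {x} xs → length (filter P? xs) ≤ length (filter P? (x ∷ xs))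
  length-filter-∷ {x} xs with P? x
  ... | yes _ = n≤1+n _
  ... | no _  = ≤-refl

module _ {A : Set} {P Q R : A → Set} (P? : Decidable P) (Q? : Decidable Q) (R? : Decidable R) where

  length-filter-≤-cover : (∀ {x} → P x → Q x ⊎ R x) → ∀ xs →
    length (filter P? xs) ≤ length (filter Q? xs) + length (filter R? xs)
  length-filter-≤-cover cover [] = z≤n
  length-filter-≤-cover cover (x ∷ xs) with ih ← length-filter-≤-cover cover xs | P? x
  ... | no _ = ≤-trans ih (+-mono-≤ (length-filter-∷ Q? xs) (length-filter-∷ R? xs))
  ... | yes px with Q? x
  ...   | yes _ = s≤s (≤-trans ih (+-monoʳ-≤ _ (length-filter-∷ R? xs)))
  ...   | no ¬qx with R? x
  ...     | yes _  = ≤-trans (s≤s ih) (≤-reflexive (≡.sym (+-suc _ _)))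
  ...     | no ¬rx = ⊥-elim ([ ¬qx , ¬rx ] (cover px))

length-≤-cover : {A : Set} {Q R : A → Set} (Q? : Decidable Q) (R? : Decidable R) →
  (∀ x → Q x ⊎ R x) → ∀ xs → length xs ≤ length (filter Q? xs) + length (filter R? xs)
length-≤-cover Q? R? cover xs = begin
  length xs                                      ≡⟨ cong length (≡.sym (filter-all ⊤? (All.universal _ xs))) ⟩
  length (filter ⊤? xs)                          ≤⟨ length-filter-≤-cover ⊤? Q? R? (λ {x} _ → cover x) xs ⟩
  length (filter Q? xs) + length (filter R? xs)  ∎
  where
  open ≤-Reasoning
  ⊤? = λ _ → yes tt

module _ {A : Set} (_≟_ : DecidableEquality A) where

  length-filter-≡-≤1 : ∀ {x xs} → Unique xs → length (filter (_≟ x) xs) ≤ 1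
  length-filter-≡-≤1 {x} {xs} xs! = unique-≤1 (Unique.filter⁺ (_≟ x) xs!) (all-filter (_≟ x) xs)
    where
    unique-≤1 : ∀ {ys} → Unique ys → All (_≡ x) ys → length ys ≤ 1
    unique-≤1 []                         _                 = z≤n
    unique-≤1 (_ ∷ [])                   _                 = s≤s z≤n
    unique-≤1 ((y≢z ∷ _) ∷ _ ∷ _) (refl ∷ refl ∷ _) = ⊥-elim (y≢z refl)

-- Ramsey's theorem

m+n≤o+p⇒m≤o⊎n≤p : ∀ {m n o p} → m + n ≤ o + p → m ≤ o ⊎ n ≤ p
m+n≤o+p⇒m≤o⊎n≤p {m} {n} {o} {p} le with m ≤? o | n ≤? p
... | yes m≤o | _       = inj₁ m≤o
... | no _    | yes n≤p = inj₂ n≤p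
... | no m≰o  | no n≰p  = ⊥-elim (<⇒≱ (+-mono-< (≰⇒> m≰o) (≰⇒> n≰p)) le)

record Homogeneous (G : Graph) (b : Bool) (P : Fin (n G) → Set) (k : ℕ) : Set where
  constructor homogeneous
  field
    vertex   : Fin k → Fin (n G)
    vertex-P : ∀ i → P (vertex i)
    distinct : ∀ i j → i ≢ j → vertex i ≢ vertex j × adj G (vertex i) (vertex j) ≡ b

module _ {G : Graph} {b : Bool} where

  homogeneous-mono : ∀ {P Q k} → (∀ {v} → P v → Q v) → Homogeneous G b P k → Homogeneous G b Q k
  homogeneous-mono P⊆Q (homogeneous f Pf hf) = homogeneous f (P⊆Q ∘ Pf) hf

  homogeneous-0 : ∀ {P} → Homogeneous G b P 0
  homogeneous-0 = homogeneous (λ ()) (λ ()) (λ ())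

  homogeneous-∷ : ∀ {P k v} → P v → Homogeneous G b (λ w → P w × v ≢ w × adj G v w ≡ b) k →
                  Homogeneous G b P (suc k)
  homogeneous-∷ {P} {k} {v} Pv (homogeneous f Pf hf) = homogeneous (v ∷ᶠ f) P-∷ h-∷
    where
    P-∷ : ∀ i → P ((v ∷ᶠ f) i)
    P-∷ zero    = Pv
    P-∷ (suc i) = proj₁ (Pf i)
    h-∷ : ∀ i j → i ≢ j → (v ∷ᶠ f) i ≢ (v ∷ᶠ f) j × adj G ((v ∷ᶠ f) i) ((v ∷ᶠ f) j) ≡ b
    h-∷ zero    zero    i≢j = ⊥-elim (i≢j refl)
    h-∷ zero    (suc j) _   = proj₂ (Pf j)
    h-∷ (suc i) zero    _   with Pf i
    ... | _ , v≢fi , v-fi = v≢fi ∘ ≡.sym , trans (sym G (f i) v) v-fi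
    h-∷ (suc i) (suc j) i≢j = hf i j (i≢j ∘ cong suc)

ramseyBound : ℕ → ℕ → ℕ
ramseyBound zero    _       = 0
ramseyBound (suc a) zero    = 0
ramseyBound (suc a) (suc c) = suc (ramseyBound a (suc c) + ramseyBound (suc a) c)

module _ (G : Graph) (v : Fin (n G)) where

  withAdjacency : Bool → List (Fin (n G)) → List (Fin (n G))
  withAdjacency b = filter (λ w → adj G v w Bool.≟ b)

  length-withAdjacency : ∀ ys → length ys ≤ length (withAdjacency true ys) + length (withAdjacency false ys)
  length-withAdjacency = length-≤-cover _ _ (λ w → dichotomy (adj G v w))
    where
    dichotomy : (x : Bool) → x ≡ true ⊎ x ≡ false
    dichotomy true  = inj₁ refl
    dichotomy false = inj₂ refl

  ∈-withAdjacency⁻ : ∀ {b w ys} → All (v ≢_) ys → w ∈ withAdjacency b ys →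
                     w ∈ v ∷ ys × v ≢ w × adj G v w ≡ b
  ∈-withAdjacency⁻ v∉ys w∈ with ∈-filter⁻ _ w∈
  ... | w∈ys , vw≡b = there w∈ys , All.lookup v∉ys w∈ys , vw≡b

ramsey : (G : Graph) (a c : ℕ) (xs : List (Fin (n G))) → Unique xs → ramseyBound a c ≤ length xs →
         Homogeneous G true (_∈ xs) a ⊎ Homogeneous G false (_∈ xs) c
ramsey G zero    c       xs _ _ = inj₁ homogeneous-0
ramsey G (suc a) zero    xs _ _ = inj₂ homogeneous-0
ramsey G (suc a) (suc c) (v ∷ ys) (v∉ys ∷ ys!) (s≤s r≤ys)
  with m+n≤o+p⇒m≤o⊎n≤p (≤-trans r≤ys (length-withAdjacency G v ys))
... | inj₁ r≤ = Sum.map (homogeneous-∷ (here refl) ∘ homogeneous-mono (∈-withAdjacency⁻ G v v∉ys))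
                        (homogeneous-mono (proj₁ ∘ ∈-withAdjacency⁻ G v v∉ys))
                        (ramsey G a (suc c) (withAdjacency G v true ys) (Unique.filter⁺ _ ys!) r≤)
... | inj₂ r≤ = Sum.map (homogeneous-mono (proj₁ ∘ ∈-withAdjacency⁻ G v v∉ys))
                        (homogeneous-∷ (here refl) ∘ homogeneous-mono (∈-withAdjacency⁻ G v v∉ys))
                        (ramsey G (suc a) c (withAdjacency G v false ys) (Unique.filter⁺ _ ys!) r≤)

module _ (G : Graph) where

  InducesPair : (J : Graph) → (Fin (n J) → Fin (n G)) → Fin (n J) → Fin (n J) → Set
  InducesPair J g x y = g x ≢ g y × adj G (g x) (g y) ≡ adj J x y

  induced : (J : Graph) (g : Fin (n J) → Fin (n G)) → (∀ {x y} → x <ᶠ y → InducesPair J g x y) → J ≤ᵢ G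
  induced J g ok = g , injective , adjacency
    where
    injective : ∀ x y → g x ≡ g y → x ≡ y
    injective x y gx≡gy with <ᶠ-cmp x y
    ... | tri< x<y _ _ = ⊥-elim (proj₁ (ok x<y) gx≡gy)
    ... | tri≈ _ x≡y _ = x≡y
    ... | tri> _ _ y<x = ⊥-elim (proj₁ (ok y<x) (≡.sym gx≡gy))
    adjacency : ∀ x y → adj G (g x) (g y) ≡ adj J x y
    adjacency x y with <ᶠ-cmp x y
    ... | tri< x<y _ _    = proj₂ (ok x<y)
    ... | tri≈ _ refl _   = trans (irrefl G (g x)) (≡.sym (irrefl J x))
    ... | tri> _ _ y<x    = trans (sym G (g x) (g y)) (trans (proj₂ (ok y<x)) (sym J y x))

  nonAdjacent-sym : ∀ {x y} → adj G x y ≡ false → adj G y x ≡ false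
  nonAdjacent-sym {x} {y} xy = trans (sym G y x) xy

  cherry⇒S3⊎coP3 : ∀ {x y z} → NonEdge G x y → NonEdge G x z → y ≢ z → S3 ≤ᵢ G ⊎ coP3 ≤ᵢ G
  cherry⇒S3⊎coP3 {x} {y} {z} (x≢y , xy) (x≢z , xz) y≢z with adj G y z in yz
  ... | false = inj₁ (induced S3 g pairs)
    where
    g = lookup (x ∷ y ∷ z ∷ [])
    pairs : ∀ {i j} → i <ᶠ j → InducesPair S3 g i j
    pairs {zero}     {suc zero}       _ = x≢y , xy
    pairs {zero}     {suc (suc zero)} _ = x≢z , xz
    pairs {suc zero} {suc (suc zero)} _ = y≢z , yz
    pairs {suc _}       {suc zero}       (s≤s ())
    pairs {suc (suc _)} {suc (suc zero)} (s≤s (s≤s ()))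
  ... | true = inj₂ (induced coP3 g pairs)
    where
    g = lookup (y ∷ x ∷ z ∷ [])
    pairs : ∀ {i j} → i <ᶠ j → InducesPair coP3 g i j
    pairs {zero}     {suc zero}       _ = x≢y ∘ ≡.sym , nonAdjacent-sym xy
    pairs {zero}     {suc (suc zero)} _ = y≢z , yz
    pairs {suc zero} {suc (suc zero)} _ = x≢z , xz
    pairs {suc _}       {suc zero}       (s≤s ())
    pairs {suc (suc _)} {suc (suc zero)} (s≤s (s≤s ()))

  nonEdge-sym : ∀ {x y} → NonEdge G x y → NonEdge G y x
  nonEdge-sym (x≢y , xy) = x≢y ∘ ≡.sym , nonAdjacent-sym xy

  private
    cherry : ∀ {x y z} → NonEdge G x y → NonEdge G x z → y ≢ z →
             S3 ≤ᵢ G ⊎ coP3 ≤ᵢ G ⊎ C4 ≤ᵢ G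
    cherry xy xz y≢z = Sum.map₂ inj₁ (cherry⇒S3⊎coP3 xy xz y≢z)

  twoNonEdges⇒S3⊎coP3⊎C4 : ∀ {a b c d} → NonEdge G a b → NonEdge G c d → ¬ SamePair a b c d →
                            S3 ≤ᵢ G ⊎ coP3 ≤ᵢ G ⊎ C4 ≤ᵢ G
  twoNonEdges⇒S3⊎coP3⊎C4 {a} {b} {c} {d} ab cd ab≠cd with a ≟ c | a ≟ d | b ≟ c | b ≟ d
  ... | yes refl | _        | _        | _        = cherry ab cd λ b≡d → ab≠cd (inj₁ (refl , b≡d))
  ... | _        | yes refl | _        | _        = cherry ab (nonEdge-sym cd) λ b≡c → ab≠cd (inj₂ (refl , b≡c))
  ... | _        | _        | yes refl | _        = cherry (nonEdge-sym ab) cd λ a≡d → ab≠cd (inj₂ (a≡d , refl))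
  ... | _        | _        | _        | yes refl =
    cherry (nonEdge-sym ab) (nonEdge-sym cd) λ a≡c → ab≠cd (inj₁ (a≡c , refl))
  ... | no a≢c   | no a≢d   | no b≢c   | no b≢d
        with adj G a c in ac | adj G a d in ad | adj G b c in bc | adj G b d in bd
  ...   | false | _     | _     | _     = cherry ab (a≢c , ac) b≢c
  ...   | true  | false | _     | _     = cherry ab (a≢d , ad) b≢d
  ...   | true  | true  | false | _     = cherry (nonEdge-sym ab) (b≢c , bc) a≢c
  ...   | true  | true  | true  | false = cherry (nonEdge-sym ab) (b≢d , bd) a≢d
  ...   | true  | true  | true  | true  = inj₂ (inj₂ (induced C4 g pairs))
    where
    g = lookup (a ∷ c ∷ b ∷ d ∷ [])
    pairs : ∀ {i j} → i <ᶠ j → InducesPair C4 g i j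
    pairs {zero}           {suc zero}             _ = a≢c , ac
    pairs {zero}           {suc (suc zero)}       _ = ab
    pairs {zero}           {suc (suc (suc zero))} _ = a≢d , ad
    pairs {suc zero}       {suc (suc zero)}       _ = b≢c ∘ ≡.sym , trans (sym G c b) bc
    pairs {suc zero}       {suc (suc (suc zero))} _ = cd
    pairs {suc (suc zero)} {suc (suc (suc zero))} _ = b≢d , bd
    pairs {suc _}             {suc zero}             (s≤s ())
    pairs {suc (suc _)}       {suc (suc zero)}       (s≤s (s≤s ()))
    pairs {suc (suc (suc _))} {suc (suc (suc zero))} (s≤s (s≤s (s≤s ())))

samePair? : ∀ {m} (a b c d : Fin m) → Dec (SamePair a b c d)
samePair? a b c d = ((a ≟ c) ×-dec (b ≟ d)) ⊎-dec ((a ≟ d) ×-dec (b ≟ c))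

-- Large graphs with two non-edges

-- For k = N such a configuration contains every N-vertex graph of ι(J) ∧ C (β = true)
-- or of ι(J) ∨ C (β = false).
CopyWithClique : (G : Graph) → Bool → Graph → ℕ → Set
CopyWithClique G β J k = Σ[ e ∈ J ≤ᵢ G ]
  Homogeneous G true (λ v → ∀ x → v ≢ proj₁ e x × adj G (proj₁ e x) v ≡ β) k

module _ (G : Graph) where

  private
    vertices : List (Fin (n G))
    vertices = allFin (n G)

  nonEdge? : ∀ t → Decidable (NonEdge G t)
  nonEdge? t v = ¬? (t ≟ v) ×-dec (adj G t v Bool.≟ false)

  nonNeighbours : Fin (n G) → List (Fin (n G))
  nonNeighbours t = filter (nonEdge? t) vertices

  adjacentToAll? : ∀ ts → Decidable (λ v → All (λ t → adj G t v ≡ true) ts)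
  adjacentToAll? ts v = All.all? (λ t → adj G t v Bool.≟ true) ts

  commonNeighbours : List (Fin (n G)) → List (Fin (n G))
  commonNeighbours ts = filter (adjacentToAll? ts) vertices

  large⇒clique⊎stable : ∀ k → ramseyBound k k ≤ n G →
                        Homogeneous G true (λ _ → ⊤) k ⊎ Homogeneous G false (λ _ → ⊤) k
  large⇒clique⊎stable k r≤n = Sum.map (homogeneous-mono _) (homogeneous-mono _) $
    ramsey G k k vertices (Unique.allFin⁺ (n G)) (≤-trans r≤n (≤-reflexive (≡.sym (length-tabulate _))))

  -- contains t itself, as adj G t t ≡ false
  closedNonNeighbours : Fin (n G) → List (Fin (n G))
  closedNonNeighbours t = filter (λ v → adj G t v Bool.≟ false) vertices

  length-closedNonNeighbours : ∀ t → length (closedNonNeighbours t) ≤ suc (length (nonNeighbours t))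
  length-closedNonNeighbours t =
    ≤-trans (length-filter-≤-cover _ (_≟ t) (nonEdge? t) split vertices)
            (+-monoˡ-≤ _ (length-filter-≡-≤1 _≟_ (Unique.allFin⁺ (n G))))
    where
    split : ∀ {v} → adj G t v ≡ false → v ≡ t ⊎ NonEdge G t v
    split {v} tv with t ≟ v
    ... | yes t≡v = inj₁ (≡.sym t≡v)
    ... | no t≢v  = inj₂ (t≢v , tv)

  length-commonNeighbours : ∀ c → (∀ t → length (closedNonNeighbours t) ≤ c) →
                            ∀ ts → n G ≤ length (commonNeighbours ts) + length ts * c
  length-commonNeighbours c few [] = begin
    n G                               ≡⟨ ≡.sym (length-tabulate _) ⟩
    length vertices                   ≡⟨ cong length (≡.sym (filter-all _ (All.universal (λ _ → []) vertices))) ⟩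
    length (commonNeighbours [])      ≡⟨ ≡.sym (+-identityʳ _) ⟩
    length (commonNeighbours []) + 0  ∎
    where open ≤-Reasoning
  length-commonNeighbours c few (t ∷ ts) = begin
    n G                                       ≤⟨ length-commonNeighbours c few ts ⟩
    length (commonNeighbours ts) + length ts * c  ≤⟨ +-monoˡ-≤ (length ts * c) split ⟩
    (common + closed) + length ts * c         ≡⟨ +-assoc common closed (length ts * c) ⟩
    common + (closed + length ts * c)         ≤⟨ +-monoʳ-≤ common (+-monoˡ-≤ (length ts * c) (few t)) ⟩
    common + length (t ∷ ts) * c              ∎
    where
    open ≤-Reasoning
    common = length (commonNeighbours (t ∷ ts))
    closed = length (closedNonNeighbours t)
    extend : ∀ {v} → All (λ u → adj G u v ≡ true) ts →
             All (λ u → adj G u v ≡ true) (t ∷ ts) ⊎ adj G t v ≡ false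
    extend {v} adj-ts with adj G t v in tv
    ... | true  = inj₁ (tv ∷ adj-ts)
    ... | false = inj₂ refl
    split = length-filter-≤-cover _ _ _ extend vertices

  manyNonNeighbours : ∀ k t → ramseyBound k k ≤ length (nonNeighbours t) →
                      CopyWithClique G false K1 k ⊎ Homogeneous G false (λ _ → ⊤) k
  manyNonNeighbours k t r≤ =
    Sum.map (λ clique → copy , homogeneous-mono attached clique) (homogeneous-mono _) $
    ramsey G k k (nonNeighbours t) (Unique.filter⁺ _ (Unique.allFin⁺ (n G))) r≤
    where
    copy : K1 ≤ᵢ G
    copy = induced G K1 (λ _ → t) (λ { {zero} {zero} () })
    attached : ∀ {v} → v ∈ nonNeighbours t → Fin 1 → v ≢ t × adj G t v ≡ false
    attached v∈ _ with ∈-filter⁻ (nonEdge? t) {xs = vertices} v∈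
    ... | _ , t≢v , tv = t≢v ∘ ≡.sym , tv

  fewNonNeighbours : ∀ k J → J ≤ᵢ G → (∀ t → length (nonNeighbours t) < ramseyBound k k) →
                     suc (n J) * ramseyBound k k ≤ n G →
                     CopyWithClique G true J k ⊎ Homogeneous G false (λ _ → ⊤) k
  fewNonNeighbours k J (g , copy) few large =
    Sum.map (λ clique → (g , copy) , homogeneous-mono attached clique) (homogeneous-mono _) $
    ramsey G k k (commonNeighbours (tabulate g)) (Unique.filter⁺ _ (Unique.allFin⁺ (n G))) r≤
    where
    R = ramseyBound k k
    r≤ : R ≤ length (commonNeighbours (tabulate g))
    r≤ = +-cancelʳ-≤ (n J * R) R _ $ begin
      R + n J * R                              ≤⟨ large ⟩
      n G                                      ≤⟨ length-commonNeighbours R closed≤R (tabulate g) ⟩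
      common + length (tabulate g) * R         ≡⟨ cong (λ m → common + m * R) (length-tabulate g) ⟩
      common + n J * R                         ∎
      where
      open ≤-Reasoning
      common = length (commonNeighbours (tabulate g))
      closed≤R = λ t → ≤-trans (length-closedNonNeighbours t) (few t)
    attached : ∀ {v} → v ∈ commonNeighbours (tabulate g) → ∀ x → v ≢ g x × adj G (g x) v ≡ true
    attached {v} v∈ x = (λ { refl → Bool.not-¬ (irrefl G v) gx-v }) , gx-v
      where
      gx-v = tabulate⁻ (proj₂ (∈-filter⁻ (adjacentToAll? (tabulate g)) {xs = vertices} v∈)) x

  -- 5 = 1 + max |V(J)| over J ∈ {S₃, P̄₃, C₄}
  noConfiguration⇒atMostOneNonEdge : ∀ k → 5 * ramseyBound k k ≤ n G →
    ¬ Homogeneous G false (λ _ → ⊤) k → ¬ CopyWithClique G false K1 k →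
    ¬ CopyWithClique G true S3 k → ¬ CopyWithClique G true coP3 k → ¬ CopyWithClique G true C4 k →
    AtMostOneNonEdge G
  noConfiguration⇒atMostOneNonEdge k large noStable noK1 noS3 nocoP3 noC4 a b c d ab cd
    with samePair? a b c d
  ... | yes ab=cd = ab=cd
  ... | no ab≠cd with any? (λ t → ramseyBound k k ≤? length (nonNeighbours t))
  ...   | yes (t , r≤) = ⊥-elim ([ noK1 , noStable ] (manyNonNeighbours k t r≤))
  ...   | no ¬many = ⊥-elim $
    [ refute S3 noS3 (n≤1+n 3) , [ refute coP3 nocoP3 (n≤1+n 3) , refute C4 noC4 ≤-refl ] ]
    (twoNonEdges⇒S3⊎coP3⊎C4 G ab cd ab≠cd)
    where
    few : ∀ t → length (nonNeighbours t) < ramseyBound k k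
    few t = ≰⇒> (λ r≤ → ¬many (t , r≤))
    refute : ∀ J → ¬ CopyWithClique G true J k → n J ≤ 4 → ¬ J ≤ᵢ G
    refute J noJ J≤4 J≤G = [ noJ , noStable ]
      (fewNonNeighbours k J J≤G few (≤-trans (*-monoˡ-≤ (ramseyBound k k) (s≤s J≤4)) large))

-- Partitions of H

Uniform : (G : Graph) → Bool → (Fin (n G) → Set) → Set
Uniform G b A = ∀ x y → A x → A y → x ≢ y → adj G x y ≡ b

embedsInto-mono : ∀ {K J A B} → (∀ {v} → B v → A v) → EmbedsInto K A J → EmbedsInto K B J
embedsInto-mono B⊆A (f , f-injective , f-adj) =
  (λ x → f x ∘ B⊆A) ,
  (λ x y Bx By → f-injective x y (B⊆A Bx) (B⊆A By)) , (λ x y Bx By → f-adj x y (B⊆A Bx) (B⊆A By))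

homogeneous⇒embedsInto : ∀ {H G b P A} → Homogeneous G b P (n H) → Uniform H b A → EmbedsInto H A G
homogeneous⇒embedsInto {H} {G} (homogeneous f _ f-distinct) A-uniform =
  (λ x _ → f x) , injective , adjacency
  where
  injective : ∀ x y _ _ → f x ≡ f y → x ≡ y
  injective x y _ _ fx≡fy with x ≟ y
  ... | yes x≡y = x≡y
  ... | no x≢y  = ⊥-elim (proj₁ (f-distinct x y x≢y) fx≡fy)
  adjacency : ∀ x y Ax Ay → adj G (f x) (f y) ≡ adj H x y
  adjacency x y Ax Ay with x ≟ y
  ... | yes refl = trans (irrefl G (f x)) (≡.sym (irrefl H x))
  ... | no x≢y   = trans (proj₂ (f-distinct x y x≢y)) (≡.sym (A-uniform x y Ax Ay x≢y))

module Relabel {G : Graph} {m l : ℕ} (c : Fin (n G) → Fin m) (ρ : ℕ → ℕ)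
               (ρ-< : ∀ {j} → j < m → ρ j < l) (ρ-injective : ∀ {i j} → ρ i ≡ ρ j → i ≡ j) where

  relabelled : Fin (n G) → Fin l
  relabelled v = fromℕ< (ρ-< (toℕ<n (c v)))

  relabelled-≡ : ∀ {v i} → relabelled v ≡ i → ρ (toℕ (c v)) ≡ toℕ i
  relabelled-≡ {v} refl = ≡.sym (toℕ-fromℕ< (ρ-< (toℕ<n (c v))))

  uniform : ∀ {b i} → (∀ v → ρ (toℕ (c v)) ≡ toℕ i → Uniform G b (λ w → c w ≡ c v)) →
            Uniform G b (λ w → relabelled w ≡ i)
  uniform old x y x∈i y∈i = old x (relabelled-≡ x∈i) x y refl (≡.sym cx≡cy)
    where
    cx≡cy = toℕ-injective (ρ-injective (trans (relabelled-≡ x∈i) (≡.sym (relabelled-≡ y∈i))))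

InH-mono : ∀ {G s t s′ t′} → s ≤ s′ → t ≤ t′ → InH G s t → InH G s′ t′
InH-mono {G} {s} {t} {s′} {t′} s≤s′ t≤t′ (c , parts) =
  relabelled , λ i → (λ i<s′ → uniform (stable i<s′)) , (λ s′≤i → uniform (clique s′≤i))
  where
  d = s′ ∸ s
  s+d≡s′ : s + d ≡ s′
  s+d≡s′ = m+[n∸m]≡n s≤s′
  shift-< : ∀ {j} → j < s + t → j + d < s′ + t′
  shift-< {j} j<s+t = begin-strict
    j + d        <⟨ +-monoˡ-< d j<s+t ⟩
    s + t + d    ≡⟨ +-comm (s + t) d ⟩
    d + (s + t)  ≡⟨ ≡.sym (+-assoc d s t) ⟩
    d + s + t    ≡⟨ cong (_+ t) (trans (+-comm d s) s+d≡s′) ⟩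
    s′ + t       ≤⟨ +-monoʳ-≤ s′ t≤t′ ⟩
    s′ + t′      ∎
    where open ≤-Reasoning
  open Relabel {G} c (_+ d) shift-< (+-cancelʳ-≡ d _ _)
  stable : ∀ {i} → toℕ i < s′ → ∀ v → toℕ (c v) + d ≡ toℕ i → Stable G (λ w → c w ≡ c v)
  stable i<s′ v cv+d≡i = proj₁ (parts (c v))
    (+-cancelʳ-< d _ s (≡.subst₂ _<_ (≡.sym cv+d≡i) (≡.sym s+d≡s′) i<s′))
  clique : ∀ {i} → s′ ≤ toℕ i → ∀ v → toℕ (c v) + d ≡ toℕ i → Clique G (λ w → c w ≡ c v)
  clique s′≤i v cv+d≡i = proj₂ (parts (c v))
    (+-cancelʳ-≤ d s _ (≡.subst₂ _≤_ (≡.sym s+d≡s′) (≡.sym cv+d≡i) s′≤i))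

toFront : ℕ → ℕ → ℕ
toFront s j with <-cmp j s
... | tri< _ _ _ = suc j
... | tri≈ _ _ _ = zero
... | tri> _ _ _ = j

fromFront : ℕ → ℕ → ℕ
fromFront s zero    = s
fromFront s (suc k) with suc k ≤? s
... | yes _ = k
... | no _  = suc k

fromFront-toFront : ∀ s j → fromFront s (toFront s j) ≡ j
fromFront-toFront s j with <-cmp j s
... | tri< j<s _ _ with suc j ≤? s
...   | yes _   = refl
...   | no j≮s  = ⊥-elim (j≮s j<s)
fromFront-toFront s j | tri≈ _ j≡s _ = ≡.sym j≡s
fromFront-toFront s (suc k) | tri> _ _ s<j with suc k ≤? s
...   | yes j≤s = ⊥-elim (<⇒≱ s<j j≤s)
...   | no _    = refl

toFront-injective : ∀ {s i j} → toFront s i ≡ toFront s j → i ≡ j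
toFront-injective {s} {i} {j} eq =
  trans (≡.sym (fromFront-toFront s i)) (trans (cong (fromFront s) eq) (fromFront-toFront s j))

toFront-< : ∀ {s j l} → j < l → s < l → toFront s j < l
toFront-< {s} {j} j<l s<l with <-cmp j s
... | tri< j<s _ _ = ≤-<-trans j<s s<l
... | tri≈ _ _ _   = ≤-<-trans z≤n s<l
... | tri> _ _ _   = j<l

fromFront-< : ∀ {s k} → 0 < k → k ≤ s → fromFront s k < s
fromFront-< {s} {suc k} _ k<s with suc k ≤? s
... | yes _   = k<s
... | no k≮s  = ⊥-elim (k≮s k<s)

fromFront-> : ∀ {s k} → s < k → s < fromFront s k
fromFront-> {s} {suc k} s<k with suc k ≤? s
... | yes k≤s = ⊥-elim (<⇒≱ s<k k≤s)
... | no _    = s<k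

RedPartition : (K : Graph) → ℕ → ℕ → Graph → Set
RedPartition K l s J = Σ[ c ∈ (Fin (n K) → Fin l) ] ∀ i →
  (toℕ i ≡ 0 → EmbedsInto K (λ v → c v ≡ i) J) ×
  (0 < toℕ i → toℕ i ≤ s → Stable K (λ v → c v ≡ i)) ×
  (s < toℕ i → Clique K (λ v → c v ≡ i))

reduced⇒¬RedPartition : ∀ {H l J} (red : IsRed H l J) → ¬ RedPartition H l (proj₁ red) J
reduced⇒¬RedPartition {H} (_ , _ , forbids) (c , parts) =
  forbids H c parts ((λ x → x) , (λ _ _ e → e) , (λ _ _ → refl))

frontRedPartition : ∀ {H G l m s} → s < l → m ≤ l → (c : Fin (n H) → Fin m) →
  (∀ v → toℕ (c v) < s → Stable H (λ w → c w ≡ c v)) →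
  (∀ v → s < toℕ (c v) → Clique H (λ w → c w ≡ c v)) →
  EmbedsInto H (λ v → toℕ (c v) ≡ s) G → RedPartition H l s G
frontRedPartition {H} {G} {s = s} s<l m≤l c stable clique embeds = relabelled , λ i →
  (λ i≡0 → embedsInto-mono {H} {G} (λ v∈i → trans (origin (relabelled-≡ v∈i)) (cong (fromFront s) i≡0)) embeds) ,
  (λ 0<i i≤s → uniform λ v cv → stable v (≡.subst (_< s) (≡.sym (origin cv)) (fromFront-< 0<i i≤s))) ,
  (λ s<i → uniform λ v cv → clique v (≡.subst (s <_) (≡.sym (origin cv)) (fromFront-> s<i)))
  where
  open Relabel {H} c (toFront s) (λ j<m → toFront-< (≤-trans j<m m≤l) s<l) toFront-injective
  origin : ∀ {v k} → toFront s (toℕ (c v)) ≡ k → toℕ (c v) ≡ fromFront s k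
  origin {v} cv = trans (≡.sym (fromFront-toFront s (toℕ (c v)))) (cong (fromFront s) cv)

uniform-toℕ : ∀ {G b m s} (c : Fin (n G) → Fin m) →
              (∀ v → toℕ (c v) ≡ s → Uniform G b (λ w → c w ≡ c v)) →
              Uniform G b (λ w → toℕ (c w) ≡ s)
uniform-toℕ c part x y x∈ y∈ = part x x∈ x y refl (toℕ-injective (trans y∈ (≡.sym x∈)))

stableSet⇒RedPartition : ∀ {H G l s} → s < l → InH H (suc s) (l ∸ suc s) →
                         Homogeneous G false (λ _ → ⊤) (n H) → RedPartition H l s G
stableSet⇒RedPartition {H} {G} s<l (c , parts) stableSet =
  frontRedPartition {H} {G} s<l (≤-reflexive (m+[n∸m]≡n s<l)) c
    (λ v cv<s → proj₁ (parts (c v)) (m<n⇒m<1+n cv<s))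
    (λ v s<cv → proj₂ (parts (c v)) s<cv)
    (homogeneous⇒embedsInto {H} stableSet
      (uniform-toℕ {H} c (λ v cv≡s → proj₁ (parts (c v)) (≤-reflexive (cong suc cv≡s)))))

cliqueSet⇒RedPartition : ∀ {H G l s} → s < l → InH H s (l ∸ s) →
                         Homogeneous G true (λ _ → ⊤) (n H) → RedPartition H l s G
cliqueSet⇒RedPartition {H} {G} s<l (c , parts) cliqueSet =
  frontRedPartition {H} {G} s<l (≤-reflexive (m+[n∸m]≡n (<⇒≤ s<l))) c
    (λ v cv<s → proj₁ (parts (c v)) cv<s)
    (λ v s<cv → proj₂ (parts (c v)) (<⇒≤ s<cv))
    (homogeneous⇒embedsInto {H} cliqueSet
      (uniform-toℕ {H} c (λ v cv≡s → proj₂ (parts (c v)) (≤-reflexive (≡.sym cv≡s)))))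

-- β = false gives InUnionC, β = true gives InJoinC.
InCliqueComposition : (H : Graph) → Bool → (Fin (n H) → Set) → Graph → Set
InCliqueComposition H β Y J = Σ[ side ∈ (Fin (n H) → Bool) ]
  EmbedsInto H (λ v → Y v × side v ≡ true) J ×
  Clique H (λ v → Y v × side v ≡ false) ×
  (∀ a b → Y a × side a ≡ true → Y b × side b ≡ false → adj H a b ≡ β)

composition⇒embedsInto : ∀ {H G β J Y} → InCliqueComposition H β Y J → CopyWithClique G β J (n H) →
                         EmbedsInto H Y G
composition⇒embedsInto {H} {G} {β} {J} {Y} (side , (f , f-injective , f-adj) , clique , across)
                                        ((g , g-injective , g-adj) , homogeneous h h-attached h-distinct) =
  (λ x Yx → image x Yx (side x) refl) ,
  (λ x y Yx Yy → injective x y Yx Yy (side x) refl (side y) refl) ,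
  (λ x y Yx Yy → adjacency x y Yx Yy (side x) refl (side y) refl)
  where
  image : ∀ x → Y x → (b : Bool) → side x ≡ b → Fin (n G)
  image x Yx true  sx = g (f x (Yx , sx))
  image x Yx false _  = h x
  adjacency : ∀ x y Yx Yy bx (sx : side x ≡ bx) by (sy : side y ≡ by) →
              adj G (image x Yx bx sx) (image y Yy by sy) ≡ adj H x y
  adjacency x y Yx Yy true sx true sy = trans (g-adj _ _) (f-adj x y _ _)
  adjacency x y Yx Yy true sx false sy =
    trans (proj₂ (h-attached y (f x (Yx , sx)))) (≡.sym (across x y (Yx , sx) (Yy , sy)))
  adjacency x y Yx Yy false sx true sy = trans (sym G (h x) _) (trans (proj₂ (h-attached x (f y (Yy , sy))))
    (trans (≡.sym (across y x (Yy , sy) (Yx , sx))) (sym H y x)))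
  adjacency x y Yx Yy false sx false sy with x ≟ y
  ... | yes refl = trans (irrefl G (h x)) (≡.sym (irrefl H x))
  ... | no x≢y   = trans (proj₂ (h-distinct x y x≢y)) (≡.sym (clique x y (Yx , sx) (Yy , sy) x≢y))
  injective : ∀ x y Yx Yy bx (sx : side x ≡ bx) by (sy : side y ≡ by) →
              image x Yx bx sx ≡ image y Yy by sy → x ≡ y
  injective x y Yx Yy true sx true sy eq = f-injective x y _ _ (g-injective _ _ eq)
  injective x y Yx Yy true sx false sy eq = ⊥-elim (proj₁ (h-attached y (f x (Yx , sx))) (≡.sym eq))
  injective x y Yx Yy false sx true sy eq = ⊥-elim (proj₁ (h-attached x (f y (Yy , sy))) eq)
  injective x y Yx Yy false sx false sy eq with x ≟ y
  ... | yes x≡y = x≡y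
  ... | no x≢y  = ⊥-elim (proj₁ (h-distinct x y x≢y) eq)

cliquesPlus⇒RedPartition : ∀ {H G k} → CliquesPlus H k (λ Y → EmbedsInto H Y G) → RedPartition H (suc k) 0 G
cliquesPlus⇒RedPartition {H} {G} {k} (c , cliques , embeds) = label ∘ c , parts
  where
  label : Maybe (Fin k) → Fin (suc k)
  label nothing  = zero
  label (just i) = suc i
  label-zero : ∀ m → label m ≡ zero → m ≡ nothing
  label-zero nothing _ = refl
  label-suc : ∀ {i} m → label m ≡ suc i → m ≡ just i
  label-suc (just i) refl = refl
  parts : ∀ i → _
  parts zero    = (λ _ → embedsInto-mono {H} {G} (λ {v} → label-zero (c v)) embeds) , (λ ()) , (λ ())
  parts (suc i) = (λ ()) , (λ _ ()) , (λ _ x y x∈ y∈ → cliques i x y (label-suc (c x) x∈) (label-suc (c y) y∈))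

-- The clique-colouring number

CliqueLabelling : (G : Graph) {l : ℕ} → (Fin (n G) → Fin l) → Set
CliqueLabelling G c = ∀ v w → c v ≡ c w → v ≢ w → adj G v w ≡ true

cliqueLabelling⇒¬NonEdge : ∀ {G l} {c : Fin (n G) → Fin l} {x y} →
                           CliqueLabelling G c → c x ≡ c y → ¬ NonEdge G x y
cliqueLabelling⇒¬NonEdge clique cx≡cy (x≢y , xy) with ≡.trans (≡.sym xy) (clique _ _ cx≡cy x≢y)
... | ()

module _ {G : Graph} {l′ : ℕ} (enough : suc l′ ≤ n G) where

  Covers : (Fin (n G) → Fin (suc l′)) → ℕ → Set
  Covers c k = ∀ i → toℕ i < k → ∃[ v ] c v ≡ i

  covers-suc : ∀ {k c} (k<l : k < suc l′) → Covers c k → ∃[ x ] c x ≡ fromℕ< k<l → Covers c (suc k)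
  covers-suc k<l covers (x , cx≡k) i i<1+k with m<1+n⇒m<n∨m≡n i<1+k
  ... | inj₁ i<k = covers i i<k
  ... | inj₂ i≡k = x , trans cx≡k (toℕ-injective (trans (toℕ-fromℕ< k<l) (≡.sym i≡k)))

  fillLabel : ∀ {k} (k<l : k < suc l′) c → CliqueLabelling G c → Covers c k →
              Σ[ c′ ∈ (Fin (n G) → Fin (suc l′)) ] CliqueLabelling G c′ × Covers c′ (suc k)
  fillLabel {k} k<l c clique covers with any? (λ v → c v ≟ fromℕ< k<l)
  ... | yes hit    = c , clique , covers-suc k<l covers hit
  ... | no missing = c′ , clique′ , covers-suc k<l covers′ (x , c′x≡new)
    where
    -- label new is unused, so by pigeonhole two vertices x ≢ y share a label; moving x alone into
    -- part new keeps all parts cliques and the label of x still covered by y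
    new = fromℕ< k<l
    c≢new : ∀ v → new ≢ c v
    c≢new v new≡cv = missing (v , ≡.sym new≡cv)
    collision = pigeonhole enough (λ v → punchOut (c≢new v))
    x = proj₁ collision
    y = proj₁ (proj₂ collision)
    x≢y : x ≢ y
    x≢y = <ᶠ⇒≢ (proj₁ (proj₂ (proj₂ collision)))
    cx≡cy : c x ≡ c y
    cx≡cy = punchOut-injective (c≢new x) (c≢new y) (proj₂ (proj₂ (proj₂ collision)))
    c′ : Fin (n G) → Fin (suc l′)
    c′ = updateAt c x (const new)
    c′x≡new : c′ x ≡ new
    c′x≡new = updateAt-updates x c
    c′≡c : ∀ {v} → v ≢ x → c′ v ≡ c v
    c′≡c {v} v≢x = updateAt-minimal v x c v≢x
    clique′ : CliqueLabelling G c′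
    clique′ v w c′v≡c′w v≢w with v ≟ x | w ≟ x
    ... | yes v≡x  | yes w≡x = ⊥-elim (v≢w (trans v≡x (≡.sym w≡x)))
    ... | yes refl | no w≢x  = ⊥-elim (c≢new w (trans (≡.sym c′x≡new) (trans c′v≡c′w (c′≡c w≢x))))
    ... | no v≢x   | yes refl =
      ⊥-elim (c≢new v (trans (≡.sym c′x≡new) (trans (≡.sym c′v≡c′w) (c′≡c v≢x))))
    ... | no v≢x   | no w≢x  = clique v w (trans (≡.sym (c′≡c v≢x)) (trans c′v≡c′w (c′≡c w≢x))) v≢w
    covers′ : Covers c′ k
    covers′ i i<k with covers i i<k
    ... | w , cw≡i with w ≟ x
    ...   | yes refl = y , trans (c′≡c (x≢y ∘ ≡.sym)) (trans (≡.sym cx≡cy) cw≡i)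
    ...   | no w≢x   = w , trans (c′≡c w≢x) cw≡i

  coverLabels : ∀ k → k ≤ suc l′ → (c : Fin (n G) → Fin (suc l′)) → CliqueLabelling G c →
                Σ[ c′ ∈ (Fin (n G) → Fin (suc l′)) ] CliqueLabelling G c′ × Covers c′ k
  coverLabels zero    _   c clique = c , clique , λ _ ()
  coverLabels (suc k) k<l c clique with coverLabels k (<⇒≤ k<l) c clique
  ... | c′ , clique′ , covers = fillLabel k<l c′ clique′ covers

  cliqueLabelling⇒partition : (c : Fin (n G) → Fin (suc l′)) → CliqueLabelling G c →
    Σ[ c′ ∈ (Fin (n G) → Fin (suc l′)) ] CliqueLabelling G c′ × IsPartition G (suc l′) c′
  cliqueLabelling⇒partition c clique with coverLabels (suc l′) ≤-refl c clique
  ... | c′ , clique′ , covers = c′ , clique′ , λ i → covers i (toℕ<n i)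

cliqueCover⇒cliqueLabelling : ∀ {G k} (cover : InH G 0 k) → CliqueLabelling G (proj₁ cover)
cliqueCover⇒cliqueLabelling (c , parts) v w cv≡cw = proj₂ (parts (c v)) z≤n v w refl (≡.sym cv≡cw)

ARS3⇒≤ : ∀ {H l c₀} → ARS3 H l c₀ → l ≤ n H
ARS3⇒≤ {c₀ = c₀} (_ , onto , _) = injective⇒≤ {f = proj₁ ∘ onto} λ {i} {j} eq →
  trans (≡.sym (proj₂ (onto i))) (trans (cong c₀ eq) (proj₂ (onto j)))

ARS3⇒¬samePartition : ∀ {H l c₀} {c : Fin (n H) → Fin l} → ARS3 H l c₀ → CliqueLabelling H c →
                      ¬ SamePartition c c₀
ARS3⇒¬samePartition {H} (_ , _ , _ , _ , _ , _ , _ , _ , _ , _ , _ , (u₁∈ , v₁∈ , u₁v₁ , _) , _)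
                    clique same =
  cliqueLabelling⇒¬NonEdge {H} clique (proj₂ (same _ _) (trans u₁∈ (≡.sym v₁∈))) u₁v₁

ARS⇒¬cliqueCover : ∀ {l H} → IsARS (suc l) H → ¬ InH H 0 (suc l)
ARS⇒¬cliqueCover {H = H} (_ , _ , c₀ , ars3 , ars4) cover
  with cliqueLabelling⇒partition {H} (ARS3⇒≤ {H} ars3) (proj₁ cover) (cliqueCover⇒cliqueLabelling {H} cover)
... | c , clique , onto with ars4 c onto (ARS3⇒¬samePartition {H} ars3 clique)
...   | _ , _ , _ , _ , _ , a∈ , b∈ , _ , _ , ab , _ =
  cliqueLabelling⇒¬NonEdge {H} clique (trans a∈ (≡.sym b∈)) ab

embedsInto-K1⇒clique : ∀ {H A} → EmbedsInto H A K1 → Clique H A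
embedsInto-K1⇒clique (f , f-injective , _) x y Ax Ay x≢y = ⊥-elim (x≢y (f-injective x y Ax Ay (same _ _)))
  where
  same : (i j : Fin 1) → i ≡ j
  same zero zero = refl

cliquesPlusK1⇒cliqueCover : ∀ {H k} → CliquesPlus H k (λ Y → InUnionC H Y K1) → InH H 0 (suc (suc k))
cliquesPlusK1⇒cliqueCover {H} {k} (c , cliques , side , K1-part , clique , _) =
  (λ v → label (c v) (side v)) , λ i → (λ ()) , (λ _ → parts i)
  where
  label : Maybe (Fin k) → Bool → Fin (suc (suc k))
  label nothing  true  = zero
  label nothing  false = suc zero
  label (just i) _     = suc (suc i)
  label-0 : ∀ m b → label m b ≡ zero → m ≡ nothing × b ≡ true
  label-0 nothing true _ = refl , refl
  label-1 : ∀ m b → label m b ≡ suc zero → m ≡ nothing × b ≡ false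
  label-1 nothing false _ = refl , refl
  label-2 : ∀ {i} m b → label m b ≡ suc (suc i) → m ≡ just i
  label-2 (just i) _     refl = refl
  label-2 nothing  true  ()
  label-2 nothing  false ()
  parts : ∀ i → Clique H (λ v → label (c v) (side v) ≡ i)
  parts zero          x y x∈ y∈ =
    embedsInto-K1⇒clique {H} K1-part x y (label-0 (c x) (side x) x∈) (label-0 (c y) (side y) y∈)
  parts (suc zero)    x y x∈ y∈ = clique x y (label-1 (c x) (side x) x∈) (label-1 (c y) (side y) y∈)
  parts (suc (suc i)) x y x∈ y∈ = cliques i x y (label-2 (c x) (side x) x∈) (label-2 (c y) (side y) y∈)

ARS⇒InH-above : ∀ {l H} → IsARS (suc l) H → ∀ l′ → suc l < l′ → ∀ s → s ≤ l′ → InH H s (l′ ∸ s)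
ARS⇒InH-above {H = H} (_ , (K1-split , _) , _) l′ l<l′ zero _ =
  InH-mono {H} z≤n l<l′ (cliquesPlusK1⇒cliqueCover {H} K1-split)
ARS⇒InH-above {l} {H} (ars1 , _) l′ l<l′ (suc s) _ with suc s ≤? suc l
... | yes s≤l = InH-mono {H} ≤-refl (∸-monoˡ-≤ (suc s) (<⇒≤ l<l′)) (ars1 (suc s) (s≤s z≤n) s≤l)
... | no s≰l  =
  InH-mono {H} (<⇒≤ (≰⇒> s≰l)) (≤-trans (≤-reflexive (n∸n≡0 (suc l))) z≤n) (ars1 (suc l) (s≤s z≤n) ≤-refl)

ARS⇒chiC : ∀ {l H} → IsARS (suc l) H → IsChiC H (suc l)
ARS⇒chiC {H = H} ars = (0 , z≤n , ARS⇒¬cliqueCover {H = H} ars) , ARS⇒InH-above {H = H} ars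

-- Reduced graphs

module _ {l H G} (ars : IsARS l H) (red : IsRed H l G) where

  private
    s = proj₁ red
    s<l = proj₁ (proj₂ red)
    ars1 = proj₁ ars

  reduced⇒¬stableSet : ¬ Homogeneous G false (λ _ → ⊤) (n H)
  reduced⇒¬stableSet stableSet = reduced⇒¬RedPartition {H} {J = G} red $
    stableSet⇒RedPartition {H} {G} s<l (ars1 (suc s) (s≤s z≤n) s<l) stableSet

  reduced⇒¬cliqueSet : 0 < s → ¬ Homogeneous G true (λ _ → ⊤) (n H)
  reduced⇒¬cliqueSet 0<s cliqueSet = reduced⇒¬RedPartition {H} {J = G} red $
    cliqueSet⇒RedPartition {H} {G} s<l (ars1 s 0<s (<⇒≤ s<l)) cliqueSet

reduced⇒¬copyWithClique : ∀ {k H G} (red : IsRed H (suc k) G) → proj₁ red ≡ 0 →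
  ∀ β J → CliquesPlus H k (λ Y → InCliqueComposition H β Y J) → ¬ CopyWithClique G β J (n H)
reduced⇒¬copyWithClique {H = H} {G} red@(_ , _ , _) refl β J (c , cliques , composition) copy =
  reduced⇒¬RedPartition {H} {J = G} red $
  cliquesPlus⇒RedPartition {H} {G} (c , cliques , composition⇒embedsInto {H} {G} {β} {J} composition copy)

reduced⇒atMostOneNonEdge : ∀ {l H G} → IsARS (suc l) H → IsRed H (suc l) G →
                           5 * ramseyBound (n H) (n H) ≤ n G → AtMostOneNonEdge G
reduced⇒atMostOneNonEdge {H = H} {G} ars@(_ , (K1-split , S3-split , C4-split , coP3-split) , _)
                         red@(zero , _) large =
  noConfiguration⇒atMostOneNonEdge G (n H) large (reduced⇒¬stableSet {H = H} {G} ars red)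
    (refute false K1 K1-split) (refute true S3 S3-split) (refute true coP3 coP3-split) (refute true C4 C4-split)
  where
  refute = reduced⇒¬copyWithClique {H = H} {G} red refl
reduced⇒atMostOneNonEdge {H = H} {G} ars red@(suc _ , _) large
  with large⇒clique⊎stable G (n H) (m+n≤o⇒m≤o _ large)
... | inj₁ cliqueSet = ⊥-elim (reduced⇒¬cliqueSet {H = H} {G} ars red (s≤s z≤n) cliqueSet)
... | inj₂ stableSet = ⊥-elim (reduced⇒¬stableSet {H = H} {G} ars red stableSet)

∣p∪q∣≤∣p∣+∣q∣ : ∀ {k} (p q : Subset k) → ∣ p ∪ q ∣ ≤ ∣ p ∣ + ∣ q ∣
∣p∪q∣≤∣p∣+∣q∣ []          []          = z≤n
∣p∪q∣≤∣p∣+∣q∣ (true ∷ p)  (true ∷ q)  = s≤s (≤-trans (∣p∪q∣≤∣p∣+∣q∣ p q) (+-monoʳ-≤ ∣ p ∣ (n≤1+n _)))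
∣p∪q∣≤∣p∣+∣q∣ (true ∷ p)  (false ∷ q) = s≤s (∣p∪q∣≤∣p∣+∣q∣ p q)
∣p∪q∣≤∣p∣+∣q∣ (false ∷ p) (true ∷ q)  = ≤-trans (s≤s (∣p∪q∣≤∣p∣+∣q∣ p q)) (≤-reflexive (≡.sym (+-suc _ _)))
∣p∪q∣≤∣p∣+∣q∣ (false ∷ p) (false ∷ q) = ∣p∪q∣≤∣p∣+∣q∣ p q

module _ {G : Graph} (S : Subset (n G)) (nonEdges⊆S : ∀ {x y} → NonEdge G x y → x ∈ₛ S) where

  private
    adjacent : ∀ {x y} → x ≢ y → y ∉ₛ S → adj G x y ≡ true
    adjacent x≢y y∉S = Bool.¬-not λ xy → y∉S (nonEdges⊆S (nonEdge-sym G (x≢y , xy)))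

  nonEdgesInside⇒star : ∀ {k} → ∣ S ∣ ≤ k → IsStar k G
  nonEdgesInside⇒star ∣S∣≤k = S , ∣S∣≤k , inj₁ (λ x y _ y∉S x≢y → adjacent x≢y y∉S) ,
    λ v v∈S → inj₁ (λ w w∉S → adjacent (λ { refl → w∉S v∈S }) w∉S)

atMostOneNonEdge⇒2-star : ∀ {G} → AtMostOneNonEdge G → IsStar 2 G
atMostOneNonEdge⇒2-star {G} atMostOne with any? (λ a → any? (λ b → nonEdge? G a b))
... | no none = nonEdgesInside⇒star {G} ∅ (λ {x} {y} xy → ⊥-elim (none (x , y , xy)))
                  (≤-trans (≤-reflexive (∣⊥∣≡0 (n G))) z≤n)
... | yes (a , b , ab) =
  nonEdgesInside⇒star {G} (⁅ a ⁆ ∪ ⁅ b ⁆) (λ {x} {y} xy → endpoint (atMostOne x y a b xy ab))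
    (≤-trans (∣p∪q∣≤∣p∣+∣q∣ ⁅ a ⁆ ⁅ b ⁆) (≤-reflexive (cong₂ _+_ (∣⁅x⁆∣≡1 a) (∣⁅x⁆∣≡1 b))))
  where
  endpoint : ∀ {x y} → SamePair x y a b → x ∈ₛ ⁅ a ⁆ ∪ ⁅ b ⁆
  endpoint (inj₁ (refl , _)) = x∈p∪q⁺ (inj₁ (x∈⁅x⁆ a))
  endpoint (inj₂ (refl , _)) = x∈p∪q⁺ (inj₂ (x∈⁅x⁆ b))

corollary3p3 : (l : ℕ) → 0 < l → (H : Graph) → IsARS l H →
    IsChiC H l ×
    (Σ[ n₀ ∈ ℕ ] ∀ (G : Graph) → IsRed H l G → n₀ ≤ n G → AtMostOneNonEdge G) ×
    IsCritical 2 H l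
corollary3p3 (suc l) _ H ars =
  ARS⇒chiC {H = H} ars ,
  (n₀ , atMostOne) ,
  (n₀ , λ K red large → atMostOneNonEdge⇒2-star {K} (atMostOne K red large))
  where
  n₀ = 5 * ramseyBound (n H) (n H)
  atMostOne : ∀ G → IsRed H (suc l) G → n₀ ≤ n G → AtMostOneNonEdge G
  atMostOne G = reduced⇒atMostOneNonEdge {H = H} {G} ars
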